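{- Let $G$ be a finite simple connected graph, $\mathcal S\in F_{sd}(G^*)$, $\mathcal P=\mathrm{EGP}(\mathcal S)$. If $|U(\mathcal S)|\le\gamma$, then $|\mathcal P_{\mathrm i}|\le|V_{\mathrm i}|$.
   Context: A set representation of a graph $H$ is a family $\mathcal S=(S_x)_{x\in V(H)}$ of nonempty sets with $xy\in E(H)$ iff $S_x\cap S_y\neq\emptyset$ for distinct $x,y$; universe $U(\mathcal S)=\bigcup_xS_x$; simple if $|S_x\cap S_y|\le1$, distinct if $S_x\neq S_y$ for distinct $x,y$. $F_{sd}(H)$ is the set of simple distinct representations of $H$ with minimum possible $|U(\mathcal S)|$. $G^*$ is the line graph of $G$ (vertices $E(G)$, adjacent iff sharing an endpoint). For $\mathcal S$ with $U(\mathcal S)=\{s_1,\dots,s_p\}$, $\mathrm{EGP}(\mathcal S)=(Q_1,\dots,Q_p)$ with $Q_j=\{e\in E(G): s_j\in S_e\}$; these are cliques of $G^*$ (possibly single vertices) and $|\mathcal P|=|U(\mathcal S)|$. For $v\in V(G)$, a clique $C$ of $G^*$ is induced by a $v$-star if all edges in $C$ are incident with $v$. A plume is a vertex of degree 1; a vertex $v$ with $d(v)\ge2$ is critical if adjacent to a plume, inland otherwise; $V_{\mathrm c}=\{v_1,\dots,v_k\}$ and $V_{\mathrm i}$ are the sets of critical and inland vertices, $m_i$ is the number of plumes adjacent to $v_i$, and $\gamma=|V_{\mathrm i}|+\sum_{i=1}^km_i$. $\mathcal P_{\mathrm c}$ is the set of cliques of $\mathcal P$ induced by a $v$-star with $v\in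 V_{\mathrm c}$, and $\mathcal P_{\mathrm i}=\mathcal P\setminus\mathcal P_{\mathrm c}$. -}

module Defs where

import Agda.Primitive

open import Data.Bool using (Bool; true; false; T; _∧_)
open import Data.Unit using (tt)
open import Data.Empty using (⊥)
import Data.Empty
open import Data.Nat using (ℕ; _≤_; _<ᵇ_; _+_)
open import Data.Fin using (Fin; toℕ; _≟_)
open import Data.Fin.Properties using (any?; all?)
open import Data.Fin.Subset using (Subset; _∈_; _∩_; Nonempty; ∣_∣)
open import Data.Fin.Subset.Properties using (_∈?_)
open import Data.List using (List; length; filter; allFin; map)
open import Data.Nat.ListAction using (sum)
open import Data.Bool.Properties using (T-irrelevant)
open import Data.Product using (Σ; ∃; _×_; _,_)
open import Data.Sum using (_⊎_)
open import Relation.Nullary using (¬_; Dec; yes; no)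
open import Relation.Nullary.Decidable using (T?; ¬?; _×-dec_; _⊎-dec_)
open import Relation.Unary using (Pred; Decidable)
open import Relation.Binary.PropositionalEquality using (_≡_; _≢_; refl; subst)
open import Relation.Binary.Construct.Closure.ReflexiveTransitive using (Star)

count : ∀ {k} {P : Pred (Fin k) Agda.Primitive.lzero} → Decidable P → ℕ
count {k} P? = length (filter P? (allFin k))

record Graph : Set where
  field
    n      : ℕ
    adj    : Fin n → Fin n → Bool
    symm   : ∀ u v → adj u v ≡ adj v u
    irrefl : ∀ u → adj u u ≡ false

module _ (G : Graph) where
  open Graph G

  Adj : Fin n → Fin n → Set
  Adj u v = T (adj u v)

  Connected : Set
  Connected = ∀ u v → Star Adj u v

  -- an (unordered) edge {a,b} is stored canonically with a < b
  isEdge : Fin n → Fin n → Bool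
  isEdge a b = (toℕ a <ᵇ toℕ b) ∧ adj a b

  record Edge : Set where
    constructor edge
    field
      a b  : Fin n
      isE  : T (isEdge a b)

  Incident : Fin n → Edge → Set
  Incident v e = v ≡ Edge.a e ⊎ v ≡ Edge.b e

  LineAdj : Edge → Edge → Set
  LineAdj e f = e ≢ f × ∃ λ v → Incident v e × Incident v f

  degree : Fin n → ℕ
  degree v = count (λ w → T? (adj v w))

  Plume : Fin n → Set
  Plume v = degree v ≡ 1

  plume? : Decidable Plume
  plume? v = degree v Data.Nat.≟ 1

  AdjPlume : Fin n → Fin n → Set
  AdjPlume v w = Adj v w × Plume w

  adjPlume? : ∀ v → Decidable (AdjPlume v)
  adjPlume? v w = T? (adj v w) ×-dec plume? w

  Critical : Fin n → Set
  Critical v = 2 ≤ degree v × ∃ (AdjPlume v)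

  critical? : Decidable Critical
  critical? v = (2 Data.Nat.≤? degree v) ×-dec any? (adjPlume? v)

  Inland : Fin n → Set
  Inland v = 2 ≤ degree v × ¬ ∃ (AdjPlume v)

  inland? : Decidable Inland
  inland? v = (2 Data.Nat.≤? degree v) ×-dec ¬? (any? (adjPlume? v))

  plumesAt : Fin n → ℕ
  plumesAt v = count (adjPlume? v)

  γ : ℕ
  γ = count inland? + sum (map plumesAt (filter critical? (allFin n)))

  numInland : ℕ
  numInland = count inland?

module _ {V : Set} (AdjH : V → V → Set) where

  IsSetRep : ∀ {p} → (V → Subset p) → Set
  IsSetRep S = (∀ x → Nonempty (S x))
             × (∀ x y → x ≢ y → (AdjH x y → Nonempty (S x ∩ S y))
                                × (Nonempty (S x ∩ S y) → AdjH x y))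

  IsSimple : ∀ {p} → (V → Subset p) → Set
  IsSimple S = ∀ x y → x ≢ y → ∣ S x ∩ S y ∣ ≤ 1

  IsDistinct : ∀ {p} → (V → Subset p) → Set
  IsDistinct S = ∀ x y → x ≢ y → S x ≢ S y

  -- U(S) = ⋃ S x is the whole of Fin p, so |U(S)| = p
  UniverseIsAll : ∀ {p} → (V → Subset p) → Set
  UniverseIsAll S = ∀ s → ∃ λ x → s ∈ S x

  IsSimpleDistinctRep : ∀ {p} → (V → Subset p) → Set
  IsSimpleDistinctRep S = IsSetRep S × IsSimple S × IsDistinct S

  InFsd : ∀ p → (V → Subset p) → Set
  InFsd p S = IsSimpleDistinctRep S × UniverseIsAll S
            × (∀ p′ (S′ : V → Subset p′) → IsSimpleDistinctRep S′
                 → UniverseIsAll S′ → p ≤ p′)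

-- EGP(S) = (Q_1,…,Q_p), Q_j = { e : s_j ∈ S_e }; P_c / P_i

module _ (G : Graph) {p : ℕ} (S : Edge G → Subset p) where
  open Graph G

  Q : Fin p → Edge G → Set
  Q j e = j ∈ S e

  InducedByStar : Fin n → Fin p → Set
  InducedByStar v j = ∀ e → Q j e → Incident G v e

  InPc : Fin p → Set
  InPc j = ∃ λ v → Critical G v × InducedByStar v j

  private
    incident? : ∀ v e → Dec (Incident G v e)
    incident? v (edge a b _) = (v ≟ a) ⊎-dec (v ≟ b)

    check : ∀ v j a b →
            Dec (∀ (pr : T (isEdge G a b)) → Q j (edge a b pr) → Incident G v (edge a b pr))
    check v j a b with T? (isEdge G a b)
    ... | no ¬pr = yes λ pr → Data.Empty.⊥-elim (¬pr pr)
    ... | yes pr with (j ∈? S (edge a b pr))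
    ...   | no j∉ = yes λ pr′ q → Data.Empty.⊥-elim (j∉ (subst (λ t → Q j (edge a b t)) (T-irrelevant pr′ pr) q))
    ...   | yes j∈ with incident? v (edge a b pr)
    ...     | yes i = yes λ _ _ → i
    ...     | no ¬i = no λ f → ¬i (f pr j∈)

  inducedByStar? : ∀ v j → Dec (InducedByStar v j)
  inducedByStar? v j with all? (λ a → all? (λ b → check v j a b))
  ... | yes f = yes λ { (edge a b pr) q → f a b pr q }
  ... | no ¬f = no λ g → ¬f λ a b pr q → g (edge a b pr) q

  inPc? : Decidable InPc
  inPc? j = any? (λ v → critical? G v ×-dec inducedByStar? v j)

  numPi : ℕ
  numPi = count (λ j → ¬? (inPc? j))

-- Since |P_i| = p - |P_c| and p ≤ γ = |V_i| + Σ_{v ∈ V_c} m(v), it suffices to show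
-- Σ_{v ∈ V_c} m(v) ≤ |P_c|. Fix a vertex v and its m(v) pendant edges vw (w a plume).
-- Their sets S_vw are distinct and pairwise adjacent in G*, so by simplicity any two of
-- them meet in exactly one point; Fisher's inequality, proved through the Gram matrix of
-- the incidence vectors over ℤ, then shows that their union U_v has at least m(v) points.
-- A point of U_v gives a clique induced by a v-star: an edge sharing a point with vw shares
-- an endpoint with it, and the plume w lies on no other edge. For distinct critical v, v′
-- the unions U_v and U_v′ are disjoint, hence Σ m(v) ≤ Σ |U_v| ≤ |P_c|.

module Submission where

open import Defs
open import Level using (0ℓ)
open import Data.Bool using (true; false; T; not)
open import Data.Bool.Properties using (T-irrelevant; T-∧)
open import Data.Empty using (⊥; ⊥-elim)
open import Data.Fin using (Fin; zero; suc; toℕ; _≟_)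
open import Data.Fin.Properties using (any?; toℕ-injective)
open import Data.Fin.Subset
  using (Subset; inside; outside; _∈_; _∉_; _⊆_; _∩_; _─_; ⁅_⁆; ∁; ∣_∣; Nonempty)
open import Data.Fin.Subset.Properties
  using ( _∈?_; x∈⁅y⁆⇒x≡y; ∣⁅x⁆∣≡1; x∉⁅y⁆⇒x≢y; p⊆q⇒∣p∣≤∣q∣; drop-∷-⊆; drop-there; ∩-idem
        ; x∈p∧x∉q⇒x∈p─q; p─q⊆p; p∩q⊆p; p∩q⊆q; x∈p∩q⁺; ∣∁p∣≡n∸∣p∣)
open import Data.List using (List; []; _∷_; filter; length; map; allFin)
import Data.List as List
open import Data.List.Membership.Propositional using () renaming (_∈_ to _∈ₗ_)
open import Data.List.Membership.Propositional.Properties using (∈-filter⁻)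
open import Data.List.Relation.Unary.All as All using ()
open import Data.List.Relation.Unary.Any as Any using ()
open import Data.List.Relation.Unary.AllPairs using (_∷_)
open import Data.List.Relation.Unary.Unique.Propositional using (Unique)
open import Data.List.Relation.Unary.Unique.Propositional.Properties using (allFin⁺; filter⁺)
open import Data.Product using (Σ; ∃; _×_; _,_; proj₁; proj₂)
open import Data.Sum using (_⊎_; inj₁; inj₂; [_,_]′)
open import Data.Vec using ([]; _∷_; tabulate; here; there)
open import Data.Vec.Properties using (lookup∘tabulate; lookup⇒[]=; []=⇒lookup; tabulate-∘)
open import Function using (_∘_; case_of_)
open import Function.Bundles using (Equivalence)
open import Relation.Binary.Definitions using (DecidableEquality; tri<; tri≈; tri>)
open import Relation.Binary.PropositionalEquality
open import Relation.Nullary using (yes; no; does; ¬_)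
open import Relation.Nullary.Decidable using (dec-true; T?; ¬?; _×-dec_)
open import Relation.Unary using (Pred; Decidable)

module Counting where

  open import Data.Fin.Subset using (_-_)
  open import Data.Nat using (ℕ; zero; suc; _+_; _∸_; _≤_; _<_; z≤n; s≤s)
  open import Data.Nat.ListAction using (sum)
  import Data.Nat.Properties as ℕP

  private variable
    n : ℕ

  x∈p─q⇒x∉q : ∀ {x : Fin n} {p q} → x ∈ p ─ q → x ∉ q
  x∈p─q⇒x∉q {p = inside ∷ p} {q = outside ∷ q} here ()
  x∈p─q⇒x∉q {p = _ ∷ p} {q = _ ∷ q} (there x∈p─q) (there x∈q) = x∈p─q⇒x∉q x∈p─q x∈q

  x∈p-y⇒x≢y : ∀ {x y : Fin n} {p} → x ∈ p - y → x ≢ y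
  x∈p-y⇒x≢y = x∉⁅y⁆⇒x≢y ∘ x∈p─q⇒x∉q

  x∈p⇒⁅x⁆⊆p : ∀ {x : Fin n} {p} → x ∈ p → ⁅ x ⁆ ⊆ p
  x∈p⇒⁅x⁆⊆p {x = x} x∈p y∈⁅x⁆ = subst (_∈ _) (sym (x∈⁅y⁆⇒x≡y x y∈⁅x⁆)) x∈p

  nonempty⇒∣p∣≥1 : ∀ {p : Subset n} → Nonempty p → 1 ≤ ∣ p ∣
  nonempty⇒∣p∣≥1 (x , x∈p) = subst (_≤ _) (∣⁅x⁆∣≡1 x) (p⊆q⇒∣p∣≤∣q∣ (x∈p⇒⁅x⁆⊆p x∈p))

  ∣p─q∣+∣q∣≡∣p∣ : ∀ {p q : Subset n} → q ⊆ p → ∣ p ─ q ∣ + ∣ q ∣ ≡ ∣ p ∣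
  ∣p─q∣+∣q∣≡∣p∣ {p = []} {q = []} _ = refl
  ∣p─q∣+∣q∣≡∣p∣ {p = outside ∷ p} {q = inside ∷ q} q⊆p with () ← q⊆p here
  ∣p─q∣+∣q∣≡∣p∣ {p = inside ∷ p} {q = inside ∷ q} q⊆p =
    trans (ℕP.+-suc _ _) (cong suc (∣p─q∣+∣q∣≡∣p∣ (drop-∷-⊆ q⊆p)))
  ∣p─q∣+∣q∣≡∣p∣ {p = outside ∷ p} {q = outside ∷ q} q⊆p = ∣p─q∣+∣q∣≡∣p∣ (drop-∷-⊆ q⊆p)
  ∣p─q∣+∣q∣≡∣p∣ {p = inside ∷ p} {q = outside ∷ q} q⊆p = cong suc (∣p─q∣+∣q∣≡∣p∣ (drop-∷-⊆ q⊆p))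

  x∈p⇒∣p∣≡1+∣p-x∣ : ∀ {x : Fin n} {p} → x ∈ p → ∣ p ∣ ≡ suc ∣ p - x ∣
  x∈p⇒∣p∣≡1+∣p-x∣ {x = x} {p = p} x∈p = begin
    ∣ p ∣                 ≡⟨ sym (∣p─q∣+∣q∣≡∣p∣ (x∈p⇒⁅x⁆⊆p x∈p)) ⟩
    ∣ p - x ∣ + ∣ ⁅ x ⁆ ∣ ≡⟨ cong (∣ p - x ∣ +_) (∣⁅x⁆∣≡1 x) ⟩
    ∣ p - x ∣ + 1         ≡⟨ ℕP.+-comm _ 1 ⟩
    suc ∣ p - x ∣         ∎
    where open ≡-Reasoning

  p⊆q∧∣p∣≡∣q∣⇒p≡q : ∀ {p q : Subset n} → p ⊆ q → ∣ p ∣ ≡ ∣ q ∣ → p ≡ q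
  p⊆q∧∣p∣≡∣q∣⇒p≡q {p = []} {q = []} _ _ = refl
  p⊆q∧∣p∣≡∣q∣⇒p≡q {p = inside ∷ p} {q = outside ∷ q} p⊆q with () ← p⊆q here
  p⊆q∧∣p∣≡∣q∣⇒p≡q {p = inside ∷ p} {q = inside ∷ q} p⊆q e =
    cong (inside ∷_) (p⊆q∧∣p∣≡∣q∣⇒p≡q (drop-∷-⊆ p⊆q) (ℕP.suc-injective e))
  p⊆q∧∣p∣≡∣q∣⇒p≡q {p = outside ∷ p} {q = outside ∷ q} p⊆q e =
    cong (outside ∷_) (p⊆q∧∣p∣≡∣q∣⇒p≡q (drop-∷-⊆ p⊆q) e)
  p⊆q∧∣p∣≡∣q∣⇒p≡q {p = outside ∷ p} {q = inside ∷ q} p⊆q e =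
    ⊥-elim (ℕP.<-irrefl e (s≤s (p⊆q⇒∣p∣≤∣q∣ (drop-∷-⊆ p⊆q))))

  ∣p∣≡1⇒x≡y : ∀ {p : Subset n} {x y} → ∣ p ∣ ≡ 1 → x ∈ p → y ∈ p → x ≡ y
  ∣p∣≡1⇒x≡y {p = p} {x} ∣p∣≡1 x∈p y∈p = sym (x∈⁅y⁆⇒x≡y x (subst (_ ∈_) (sym ⁅x⁆≡p) y∈p))
    where
    ⁅x⁆≡p : ⁅ x ⁆ ≡ p
    ⁅x⁆≡p = p⊆q∧∣p∣≡∣q∣⇒p≡q (x∈p⇒⁅x⁆⊆p x∈p) (trans (∣⁅x⁆∣≡1 x) (sym ∣p∣≡1))

  ∣p∣>0⇒nonempty : ∀ {p : Subset n} → 0 < ∣ p ∣ → Nonempty p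
  ∣p∣>0⇒nonempty {p = inside ∷ p} _ = zero , here
  ∣p∣>0⇒nonempty {p = outside ∷ p} 0<∣p∣ with x , x∈p ← ∣p∣>0⇒nonempty 0<∣p∣ = suc x , there x∈p

  ∣p∩q∣≡∣p∣≡∣q∣⇒p≡q : ∀ {p q : Subset n} → ∣ p ∩ q ∣ ≡ ∣ p ∣ → ∣ p ∩ q ∣ ≡ ∣ q ∣ → p ≡ q
  ∣p∩q∣≡∣p∣≡∣q∣⇒p≡q {p = p} {q} e₁ e₂ =
    trans (sym (p⊆q∧∣p∣≡∣q∣⇒p≡q (p∩q⊆p p q) e₁)) (p⊆q∧∣p∣≡∣q∣⇒p≡q (p∩q⊆q p q) e₂)

  toSubset : {P : Pred (Fin n) 0ℓ} → Decidable P → Subset n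
  toSubset P? = tabulate (does ∘ P?)

  module _ {P : Pred (Fin n) 0ℓ} (P? : Decidable P) where

    ∈-toSubset⁺ : ∀ {x} → P x → x ∈ toSubset P?
    ∈-toSubset⁺ {x} px = lookup⇒[]= x _ (trans (lookup∘tabulate _ x) (dec-true (P? x) px))

    ∈-toSubset⁻ : ∀ {x} → x ∈ toSubset P? → P x
    ∈-toSubset⁻ {x} x∈ with P? x | trans (sym (lookup∘tabulate (does ∘ P?) x)) ([]=⇒lookup x∈)
    ... | yes px | _ = px

  length-filter-tabulate : ∀ {a} {A : Set a} {P : Pred A 0ℓ} (P? : Decidable P) (f : Fin n → A) →
    length (filter P? (List.tabulate f)) ≡ ∣ tabulate (does ∘ P? ∘ f) ∣
  length-filter-tabulate {zero} P? f = refl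
  length-filter-tabulate {suc n} P? f with does (P? (f zero))
  ... | true  = cong suc (length-filter-tabulate P? (f ∘ suc))
  ... | false = length-filter-tabulate P? (f ∘ suc)

  count≡∣toSubset∣ : ∀ {P : Pred (Fin n) 0ℓ} (P? : Decidable P) → count P? ≡ ∣ toSubset P? ∣
  count≡∣toSubset∣ P? = length-filter-tabulate P? (λ x → x)

  count-¬ : ∀ {P : Pred (Fin n) 0ℓ} (P? : Decidable P) → count (¬? ∘ P?) ≡ n ∸ count P?
  count-¬ {n} P? = begin
    count (¬? ∘ P?)           ≡⟨ count≡∣toSubset∣ (¬? ∘ P?) ⟩
    ∣ toSubset (¬? ∘ P?) ∣    ≡⟨ cong ∣_∣ (tabulate-∘ not (does ∘ P?)) ⟩
    ∣ ∁ (toSubset P?) ∣       ≡⟨ ∣∁p∣≡n∸∣p∣ (toSubset P?) ⟩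
    n ∸ ∣ toSubset P? ∣       ≡⟨ cong (n ∸_) (count≡∣toSubset∣ P?) ⟨
    n ∸ count P?              ∎
    where open ≡-Reasoning

  module _ {a} {A : Set a} {p} (U : A → Subset p) where

    sum-≤-∣∣-disjoint : (f : A → ℕ) (Q : Subset p) (xs : List A) → Unique xs
      → (∀ {x} → x ∈ₗ xs → f x ≤ ∣ U x ∣)
      → (∀ {x} → x ∈ₗ xs → U x ⊆ Q)
      → (∀ {x y k} → x ∈ₗ xs → y ∈ₗ xs → k ∈ U x → k ∈ U y → x ≡ y)
      → sum (map f xs) ≤ ∣ Q ∣
    sum-≤-∣∣-disjoint f Q [] _ _ _ _ = z≤n
    sum-≤-∣∣-disjoint f Q (x ∷ xs) (x∉xs ∷ xs!) f≤ U⊆Q disjoint = begin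
      f x + sum (map f xs)     ≤⟨ ℕP.+-mono-≤ (f≤ (Any.here refl)) rest≤ ⟩
      ∣ U x ∣ + ∣ Q ─ U x ∣    ≡⟨ ℕP.+-comm ∣ U x ∣ _ ⟩
      ∣ Q ─ U x ∣ + ∣ U x ∣    ≡⟨ ∣p─q∣+∣q∣≡∣p∣ (U⊆Q (Any.here refl)) ⟩
      ∣ Q ∣                    ∎
      where
      open ℕP.≤-Reasoning
      U⊆Q─Ux : ∀ {y} → y ∈ₗ xs → U y ⊆ Q ─ U x
      U⊆Q─Ux y∈xs k∈Uy = x∈p∧x∉q⇒x∈p─q (U⊆Q (Any.there y∈xs) k∈Uy) λ k∈Ux →
        All.lookup x∉xs y∈xs (disjoint (Any.here refl) (Any.there y∈xs) k∈Ux k∈Uy)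
      rest≤ : sum (map f xs) ≤ ∣ Q ─ U x ∣
      rest≤ = sum-≤-∣∣-disjoint f (Q ─ U x) xs xs! (f≤ ∘ Any.there) U⊆Q─Ux
        (λ x∈ y∈ → disjoint (Any.there x∈) (Any.there y∈))

module Fisher where

  open import Data.Integer using (ℤ; +_; -[1+_]; 0ℤ; 1ℤ; _+_; _*_; _-_; _≤_; +≤+)
  import Data.Integer as ℤ
  import Data.Integer.Properties as ℤP
  open import Data.Integer.Tactic.RingSolver using (solve-∀)
  open import Data.Nat as ℕ using (ℕ; zero; suc; z≤n)
  import Data.Nat.Properties as ℕP
  open import Algebra.Properties.Semiring.Sum ℤP.+-*-semiring
    using (sum; sum-syntax; sum-cong-≗; sum-replicate-zero; ∑-comm; ∑-distrib-+; *-distribˡ-sum; *-distribʳ-sum)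
  open Counting using (∣p∣>0⇒nonempty; nonempty⇒∣p∣≥1; x∈p-y⇒x≢y; x∈p⇒∣p∣≡1+∣p-x∣; ∣p∩q∣≡∣p∣≡∣q∣⇒p≡q)

  private variable
    n : ℕ

  δ : Fin n → Fin n → ℤ
  δ zero    zero    = 1ℤ
  δ zero    (suc _) = 0ℤ
  δ (suc _) zero    = 0ℤ
  δ (suc i) (suc j) = δ i j

  δ-refl : (i : Fin n) → δ i i ≡ 1ℤ
  δ-refl zero    = refl
  δ-refl (suc i) = δ-refl i

  δ-≢ : {i j : Fin n} → i ≢ j → δ i j ≡ 0ℤ
  δ-≢ {i = zero}  {zero}  i≢j = ⊥-elim (i≢j refl)
  δ-≢ {i = zero}  {suc j} _   = refl
  δ-≢ {i = suc i} {zero}  _   = refl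
  δ-≢ {i = suc i} {suc j} i≢j = δ-≢ (i≢j ∘ cong suc)

  ∑-δ : (i : Fin n) (f : Fin n → ℤ) → ∑[ j < n ] (δ i j * f j) ≡ f i
  ∑-δ {suc n} zero f = trans (cong₂ _+_ (ℤP.*-identityˡ (f zero)) (sum-replicate-zero n)) (ℤP.+-identityʳ (f zero))
  ∑-δ {suc n} (suc i) f = trans (ℤP.+-identityˡ _) (∑-δ i (f ∘ suc))

  ∑-distrib-− : (f g : Fin n → ℤ) → ∑[ i < n ] (f i - g i) ≡ ∑[ i < n ] f i - ∑[ i < n ] g i
  ∑-distrib-− {zero}  f g = refl
  ∑-distrib-− {suc n} f g = trans (cong (_+_ (f zero - g zero)) (∑-distrib-− (f ∘ suc) (g ∘ suc)))
    (regroup (f zero) (g zero) (sum (f ∘ suc)) (sum (g ∘ suc)))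
    where
    regroup : ∀ a b c d → (a - b) + (c - d) ≡ (a + c) - (b + d)
    regroup = solve-∀

  ∑-zero : {f : Fin n → ℤ} → (∀ i → f i ≡ 0ℤ) → ∑[ i < n ] f i ≡ 0ℤ
  ∑-zero {n} f≡0 = trans (sum-cong-≗ f≡0) (sum-replicate-zero n)

  i*i≥0 : ∀ i → 0ℤ ≤ i * i
  i*i≥0 (+ zero)     = +≤+ z≤n
  i*i≥0 (+ suc _)    = +≤+ z≤n
  i*i≥0 -[1+ _ ]     = +≤+ z≤n

  nonNeg-+-≡0 : ∀ {i j} → 0ℤ ≤ i → 0ℤ ≤ j → i + j ≡ 0ℤ → i ≡ 0ℤ × j ≡ 0ℤ
  nonNeg-+-≡0 (+≤+ {n = m} _) (+≤+ {n = n} _) m+n≡0 =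
    cong +_ (ℕP.m+n≡0⇒m≡0 m (ℤP.+-injective m+n≡0)) , cong +_ (ℕP.m+n≡0⇒n≡0 m (ℤP.+-injective m+n≡0))

  ∑-nonNeg : {f : Fin n → ℤ} → (∀ i → 0ℤ ≤ f i) → 0ℤ ≤ ∑[ i < n ] f i
  ∑-nonNeg {zero}  _   = +≤+ z≤n
  ∑-nonNeg {suc n} f≥0 = ℤP.+-mono-≤ (f≥0 zero) (∑-nonNeg (f≥0 ∘ suc))

  ∑-nonNeg-≡0 : {f : Fin n → ℤ} → (∀ i → 0ℤ ≤ f i) → ∑[ i < n ] f i ≡ 0ℤ → ∀ i → f i ≡ 0ℤ
  ∑-nonNeg-≡0 f≥0 ∑f≡0 zero    = proj₁ (nonNeg-+-≡0 (f≥0 zero) (∑-nonNeg (f≥0 ∘ suc)) ∑f≡0)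
  ∑-nonNeg-≡0 f≥0 ∑f≡0 (suc i) =
    ∑-nonNeg-≡0 (f≥0 ∘ suc) (proj₂ (nonNeg-+-≡0 (f≥0 zero) (∑-nonNeg (f≥0 ∘ suc)) ∑f≡0)) i

  -- The suc clause comes first so that χ (b ∷ p) (suc k) reduces for a variable b.
  χ : Subset n → Fin n → ℤ
  χ (_       ∷ p) (suc k) = χ p k
  χ (inside  ∷ _) zero    = 1ℤ
  χ (outside ∷ _) zero    = 0ℤ

  χ-∉ : ∀ {p : Subset n} {k} → k ∉ p → χ p k ≡ 0ℤ
  χ-∉ {p = inside  ∷ _} {zero}  k∉p = ⊥-elim (k∉p here)
  χ-∉ {p = outside ∷ _} {zero}  _   = refl
  χ-∉ {p = _       ∷ p} {suc k} k∉p = χ-∉ {p = p} (k∉p ∘ there)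

  ∑χχ≡∣∩∣ : (p q : Subset n) → ∑[ k < n ] (χ p k * χ q k) ≡ + ∣ p ∩ q ∣
  ∑χχ≡∣∩∣ []            []            = refl
  ∑χχ≡∣∩∣ (inside  ∷ p) (inside  ∷ q) = cong (_+_ 1ℤ) (∑χχ≡∣∩∣ p q)
  ∑χχ≡∣∩∣ (inside  ∷ p) (outside ∷ q) = trans (ℤP.+-identityˡ _) (∑χχ≡∣∩∣ p q)
  ∑χχ≡∣∩∣ (outside ∷ p) (_       ∷ q) = trans (ℤP.+-identityˡ _) (∑χχ≡∣∩∣ p q)

  record LinearDependence {N p} (P : Subset N) (x : Fin N → Fin p → ℤ) : Set where
    field
      coeff    : Fin N → ℤ
      coeff-∉  : ∀ {i} → i ∉ P → coeff i ≡ 0ℤ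
      nonzero  : ∃ λ i → coeff i ≢ 0ℤ
      relation : ∀ k → ∑[ i < N ] (coeff i * x i k) ≡ 0ℤ

  module _ {N p} {P : Subset N} {x : Fin N → Fin (suc p) → ℤ} where

    extend-by-zero-column : (∀ {i} → i ∈ P → x i zero ≡ 0ℤ)
      → LinearDependence P (λ i k → x i (suc k)) → LinearDependence P x
    extend-by-zero-column column₀≡0 dep = record
      { coeff = c ; coeff-∉ = c-∉ ; nonzero = c-nonzero ; relation = c-relation }
      where
      open LinearDependence dep renaming (coeff to c; coeff-∉ to c-∉; nonzero to c-nonzero; relation to rel)
      term₀≡0 : ∀ i → c i * x i zero ≡ 0ℤ
      term₀≡0 i with i ∈? P
      ... | yes i∈P = trans (cong (c i *_) (column₀≡0 i∈P)) (ℤP.*-zeroʳ (c i))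
      ... | no  i∉P = cong (_* x i zero) (c-∉ i∉P)
      c-relation : ∀ k → ∑[ i < N ] (c i * x i k) ≡ 0ℤ
      c-relation zero    = ∑-zero term₀≡0
      c-relation (suc k) = rel k

    -- Fraction-free Gaussian elimination with pivot x i₀ 0: a dependence of the rows
    -- a · x i − x i 0 · x i₀ (restricted to columns 1…) lifts to one of the rows x i.
    eliminate-pivot : ∀ {i₀} → i₀ ∈ P → x i₀ zero ≢ 0ℤ
      → LinearDependence (P ─ ⁅ i₀ ⁆) (λ i k → x i₀ zero * x i (suc k) - x i zero * x i₀ (suc k))
      → LinearDependence P x
    eliminate-pivot {i₀} i₀∈P a≢0 dep = record
      { coeff = c ; coeff-∉ = c-∉ ; nonzero = c-nonzero ; relation = c-relation }
      where
      open LinearDependence dep renaming (coeff to d; coeff-∉ to d-∉; nonzero to d-nonzero; relation to d-relation)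
      a D : ℤ
      a = x i₀ zero
      D = ∑[ i < N ] (d i * x i zero)
      c : Fin N → ℤ
      c i = a * d i - δ i₀ i * D

      c-∉ : ∀ {i} → i ∉ P → c i ≡ 0ℤ
      c-∉ {i} i∉P = begin
        a * d i - δ i₀ i * D   ≡⟨ cong₂ (λ u v → a * u - v * D) (d-∉ (i∉P ∘ p─q⊆p P ⁅ i₀ ⁆)) (δ-≢ i₀≢i) ⟩
        a * 0ℤ - 0ℤ * D        ≡⟨ cong (_- 0ℤ * D) (ℤP.*-zeroʳ a) ⟩
        0ℤ                     ∎
        where
        open ≡-Reasoning
        i₀≢i : i₀ ≢ i
        i₀≢i refl = i∉P i₀∈P

      c-nonzero : ∃ λ i → c i ≢ 0ℤ
      c-nonzero with j , dj≢0 ← d-nonzero with j ∈? (P ─ ⁅ i₀ ⁆)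
      ... | no  j∉ = ⊥-elim (dj≢0 (d-∉ j∉))
      ... | yes j∈ = j , λ cj≡0 → [ a≢0 , dj≢0 ]′ (ℤP.i*j≡0⇒i≡0∨j≡0 a (trans (sym c≡ad) cj≡0))
        where
        c≡ad : c j ≡ a * d j
        c≡ad = trans (cong (λ v → a * d j - v * D) (δ-≢ (x∈p-y⇒x≢y j∈ ∘ sym))) (ℤP.+-identityʳ _)

      column : ∀ k → ∑[ i < N ] (c i * x i k) ≡ ∑[ i < N ] (d i * (a * x i k - x i zero * x i₀ k))
      column k = begin
        ∑[ i < N ] (c i * x i k)
          ≡⟨ sum-cong-≗ (λ i → expandˡ a (d i) (δ i₀ i) D (x i k)) ⟩
        ∑[ i < N ] (a * (d i * x i k) - δ i₀ i * (D * x i k))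
          ≡⟨ ∑-distrib-− (λ i → a * (d i * x i k)) (λ i → δ i₀ i * (D * x i k)) ⟩
        (∑[ i < N ] (a * (d i * x i k))) - (∑[ i < N ] (δ i₀ i * (D * x i k)))
          ≡⟨ cong₂ _-_ (sym (*-distribˡ-sum a dx)) (∑-δ i₀ (λ i → D * x i k)) ⟩
        a * Dₖ - D * x i₀ k
          ≡⟨ cong (λ v → a * Dₖ - v) (*-distribʳ-sum (x i₀ k) (λ i → d i * x i zero)) ⟩
        a * Dₖ - (∑[ i < N ] (d i * x i zero * x i₀ k))
          ≡⟨ cong (λ v → v - (∑[ i < N ] (d i * x i zero * x i₀ k))) (*-distribˡ-sum a dx) ⟩
        (∑[ i < N ] (a * (d i * x i k))) - (∑[ i < N ] (d i * x i zero * x i₀ k))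
          ≡⟨ ∑-distrib-− (λ i → a * (d i * x i k)) (λ i → d i * x i zero * x i₀ k) ⟨
        ∑[ i < N ] (a * (d i * x i k) - d i * x i zero * x i₀ k)
          ≡⟨ sum-cong-≗ (λ i → expandʳ a (d i) (x i k) (x i zero) (x i₀ k)) ⟨
        ∑[ i < N ] (d i * (a * x i k - x i zero * x i₀ k))
          ∎
        where
        open ≡-Reasoning
        dx : Fin N → ℤ
        dx i = d i * x i k
        Dₖ : ℤ
        Dₖ = ∑[ i < N ] dx i
        expandˡ : ∀ a d e D y → (a * d - e * D) * y ≡ a * (d * y) - e * (D * y)
        expandˡ = solve-∀
        expandʳ : ∀ a d y y₀ z → d * (a * y - y₀ * z) ≡ a * (d * y) - d * y₀ * z
        expandʳ = solve-∀

      c-relation : ∀ k → ∑[ i < N ] (c i * x i k) ≡ 0ℤ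
      c-relation zero    = trans (column zero) (∑-zero λ i → cancel (d i) a (x i zero))
        where
        cancel : ∀ d a y → d * (a * y - y * a) ≡ 0ℤ
        cancel = solve-∀
      c-relation (suc k) = trans (column (suc k)) (d-relation k)

  ∣U∣<∣P∣⇒LinearDependence : ∀ {N} p (P : Subset N) (U : Subset p) (x : Fin N → Fin p → ℤ)
    → (∀ {i k} → i ∈ P → k ∉ U → x i k ≡ 0ℤ) → ∣ U ∣ ℕ.< ∣ P ∣ → LinearDependence P x
  ∣U∣<∣P∣⇒LinearDependence zero P [] x _ 0<∣P∣ with i , i∈P ← ∣p∣>0⇒nonempty {p = P} 0<∣P∣ = record
    { coeff    = δ i
    ; coeff-∉  = λ {j} j∉P → δ-≢ {i = i} {j} λ { refl → j∉P i∈P }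
    ; nonzero  = i , λ δii≡0 → case trans (sym (δ-refl i)) δii≡0 of λ ()
    ; relation = λ ()
    }
  ∣U∣<∣P∣⇒LinearDependence (suc p) P (outside ∷ U) x supp ∣U∣<∣P∣ =
    extend-by-zero-column (λ i∈P → supp i∈P λ ())
      (∣U∣<∣P∣⇒LinearDependence p P U (λ i k → x i (suc k)) (λ i∈P k∉U → supp i∈P (k∉U ∘ drop-there)) ∣U∣<∣P∣)
  ∣U∣<∣P∣⇒LinearDependence (suc p) P (inside ∷ U) x supp ∣U∣<∣P∣
    with any? (λ i → i ∈? P ×-dec ¬? (x i zero ℤ.≟ 0ℤ))
  ... | no column₀-vanishes = extend-by-zero-column column₀≡0
    (∣U∣<∣P∣⇒LinearDependence p P U (λ i k → x i (suc k)) (λ i∈P k∉U → supp i∈P (k∉U ∘ drop-there))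
      (ℕP.<-trans (ℕP.n<1+n ∣ U ∣) ∣U∣<∣P∣))
    where
    column₀≡0 : ∀ {i} → i ∈ P → x i zero ≡ 0ℤ
    column₀≡0 {i} i∈P with x i zero ℤ.≟ 0ℤ
    ... | yes x≡0 = x≡0
    ... | no  x≢0 = ⊥-elim (column₀-vanishes (i , i∈P , x≢0))
  ... | yes (i₀ , i₀∈P , a≢0) = eliminate-pivot i₀∈P a≢0
    (∣U∣<∣P∣⇒LinearDependence p (P ─ ⁅ i₀ ⁆) U _ supp′
      (ℕP.≤-pred (ℕP.≤-trans ∣U∣<∣P∣ (ℕP.≤-reflexive (x∈p⇒∣p∣≡1+∣p-x∣ i₀∈P)))))
    where
    supp′ : ∀ {i k} → i ∈ P ─ ⁅ i₀ ⁆ → k ∉ U → x i₀ zero * x i (suc k) - x i zero * x i₀ (suc k) ≡ 0ℤ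
    supp′ {i} i∈ k∉U
      rewrite supp (p─q⊆p P ⁅ i₀ ⁆ i∈) (k∉U ∘ drop-there) | supp i₀∈P (k∉U ∘ drop-there) =
      cong₂ _-_ (ℤP.*-zeroʳ (x i₀ zero)) (ℤP.*-zeroʳ (x i zero))

  module _ {N p} {P : Subset N} {A : Fin N → Subset p}
    (nonempty : ∀ {i} → i ∈ P → Nonempty (A i))
    (meet : ∀ {i j} → i ∈ P → j ∈ P → i ≢ j → ∣ A i ∩ A j ∣ ≡ 1)
    (distinct : ∀ {i j} → i ∈ P → j ∈ P → i ≢ j → A i ≢ A j)
    where

    private module Gram (dep : LinearDependence P (χ ∘ A)) where
      open LinearDependence dep renaming (coeff to c)

      C : ℤ
      C = ∑[ j < N ] c j

      s : Fin N → ℕ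
      s i = ∣ A i ∣ ℕ.∸ 1

      ∣A∣≡1+s : ∀ {i} → i ∈ P → ∣ A i ∣ ≡ suc (s i)
      ∣A∣≡1+s i∈P = sym (ℕP.m+[n∸m]≡n (nonempty⇒∣p∣≥1 (nonempty i∈P)))

      gram-row : ∀ i → ∑[ j < N ] (c j * + ∣ A i ∩ A j ∣) ≡ 0ℤ
      gram-row i = begin
        ∑[ j < N ] (c j * + ∣ A i ∩ A j ∣)
          ≡⟨ sum-cong-≗ (λ j → cong (c j *_) (∑χχ≡∣∩∣ (A i) (A j))) ⟨
        ∑[ j < N ] (c j * (∑[ k < p ] (χ (A i) k * χ (A j) k)))
          ≡⟨ sum-cong-≗ (λ j → trans (*-distribˡ-sum (c j) (λ k → χ (A i) k * χ (A j) k))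
                                     (sum-cong-≗ λ k → swap (c j) (χ (A i) k) (χ (A j) k))) ⟩
        ∑[ j < N ] ∑[ k < p ] (χ (A i) k * (c j * χ (A j) k))
          ≡⟨ ∑-comm (λ j k → χ (A i) k * (c j * χ (A j) k)) ⟩
        ∑[ k < p ] ∑[ j < N ] (χ (A i) k * (c j * χ (A j) k))
          ≡⟨ sum-cong-≗ (λ k → sym (*-distribˡ-sum (χ (A i) k) (λ j → c j * χ (A j) k))) ⟩
        ∑[ k < p ] (χ (A i) k * (∑[ j < N ] (c j * χ (A j) k)))
          ≡⟨ ∑-zero (λ k → trans (cong (χ (A i) k *_) (relation k)) (ℤP.*-zeroʳ (χ (A i) k))) ⟩
        0ℤ ∎
        where
        open ≡-Reasoning
        swap : ∀ a b d → a * (b * d) ≡ b * (a * d)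
        swap = solve-∀

      gram-entry : ∀ {i} → i ∈ P → ∀ j → c j * + ∣ A i ∩ A j ∣ ≡ c j + δ i j * (c i * + s i)
      gram-entry {i} i∈P j with j ≟ i
      ... | yes refl rewrite ∩-idem (A i) | ∣A∣≡1+s i∈P | δ-refl i = expand (c i) (+ s i)
        where
        expand : ∀ a t → a * (1ℤ + t) ≡ a + 1ℤ * (a * t)
        expand = solve-∀
      ... | no j≢i rewrite δ-≢ (j≢i ∘ sym) = trans off-diagonal (sym (ℤP.+-identityʳ (c j)))
        where
        off-diagonal : c j * + ∣ A i ∩ A j ∣ ≡ c j
        off-diagonal with j ∈? P
        ... | yes j∈P rewrite meet i∈P j∈P (j≢i ∘ sym) = ℤP.*-identityʳ (c j)
        ... | no  j∉P rewrite coeff-∉ j∉P = refl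

      row-relation : ∀ {i} → i ∈ P → C + c i * + s i ≡ 0ℤ
      row-relation {i} i∈P = begin
        C + c i * + s i
          ≡⟨ cong (_+_ C) (∑-δ i (λ _ → c i * + s i)) ⟨
        C + ∑[ j < N ] (δ i j * (c i * + s i))
          ≡⟨ ∑-distrib-+ c (λ j → δ i j * (c i * + s i)) ⟨
        ∑[ j < N ] (c j + δ i j * (c i * + s i))
          ≡⟨ sum-cong-≗ (gram-entry i∈P) ⟨
        ∑[ j < N ] (c j * + ∣ A i ∩ A j ∣)
          ≡⟨ gram-row i ⟩
        0ℤ ∎
        where open ≡-Reasoning

      q : Fin N → ℤ
      q i = c i * c i * + s i

      q≥0 : ∀ i → 0ℤ ≤ q i
      q≥0 i = ℤP.*-monoʳ-≤-nonNeg (+ s i) (i*i≥0 (c i))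

      -- Weighting each row relation by c i gives the Gram form  ∑ c i ² (∣A i∣ - 1) + (∑ c i)² = 0.
      quadratic : ∑[ i < N ] q i + C * C ≡ 0ℤ
      quadratic = begin
        ∑[ i < N ] q i + C * C
          ≡⟨ cong (_+_ (∑[ i < N ] q i)) (*-distribʳ-sum C c) ⟩
        ∑[ i < N ] q i + ∑[ i < N ] (c i * C)
          ≡⟨ ∑-distrib-+ q (λ i → c i * C) ⟨
        ∑[ i < N ] (q i + c i * C)
          ≡⟨ ∑-zero weighted-row ⟩
        0ℤ ∎
        where
        open ≡-Reasoning
        expand : ∀ a C t → a * a * t + a * C ≡ a * (C + a * t)
        expand = solve-∀
        weighted-row : ∀ i → q i + c i * C ≡ 0ℤ
        weighted-row i with i ∈? P
        ... | yes i∈P = trans (expand (c i) C (+ s i)) (trans (cong (c i *_) (row-relation i∈P)) (ℤP.*-zeroʳ (c i)))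
        ... | no  i∉P rewrite coeff-∉ i∉P = refl

      ∑q≡0×C*C≡0 : ∑[ i < N ] q i ≡ 0ℤ × C * C ≡ 0ℤ
      ∑q≡0×C*C≡0 = nonNeg-+-≡0 (∑-nonNeg q≥0) (i*i≥0 C) quadratic

      C≡0 : C ≡ 0ℤ
      C≡0 with ℤP.i*j≡0⇒i≡0∨j≡0 C (proj₂ ∑q≡0×C*C≡0)
      ... | inj₁ C≡0 = C≡0
      ... | inj₂ C≡0 = C≡0

      support-singleton : ∀ {i} → c i ≢ 0ℤ → i ∈ P × ∣ A i ∣ ≡ 1
      support-singleton {i} cᵢ≢0 with i ∈? P
      ... | no  i∉P = ⊥-elim (cᵢ≢0 (coeff-∉ i∉P))
      ... | yes i∈P = i∈P , trans (∣A∣≡1+s i∈P) (cong suc s≡0)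
        where
        qᵢ≡0 : q i ≡ 0ℤ
        qᵢ≡0 = ∑-nonNeg-≡0 q≥0 (proj₁ ∑q≡0×C*C≡0) i
        s≡0 : s i ≡ 0
        s≡0 with ℤP.i*j≡0⇒i≡0∨j≡0 (c i * c i) qᵢ≡0
        ... | inj₂ sᵢ≡0 = ℤP.+-injective sᵢ≡0
        ... | inj₁ cᵢ²≡0 = ⊥-elim ([ cᵢ≢0 , cᵢ≢0 ]′ (ℤP.i*j≡0⇒i≡0∨j≡0 (c i) cᵢ²≡0))

      -- Two distinct singletons cannot meet, so c is supported on a single row and C = c i₀ ≠ 0.
      absurd : ⊥
      absurd with i₀ , cᵢ₀≢0 ← nonzero = cᵢ₀≢0 (trans (sym C≡cᵢ₀) C≡0)
        where
        supported : ∀ j → j ≢ i₀ → c j ≡ 0ℤ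
        supported j j≢i₀ with c j ℤ.≟ 0ℤ
        ... | yes cⱼ≡0 = cⱼ≡0
        ... | no  cⱼ≢0 with i₀∈P , ∣Aᵢ₀∣≡1 ← support-singleton cᵢ₀≢0
                          | j∈P , ∣Aⱼ∣≡1 ← support-singleton cⱼ≢0 =
          ⊥-elim (distinct i₀∈P j∈P (j≢i₀ ∘ sym)
            (∣p∩q∣≡∣p∣≡∣q∣⇒p≡q (trans ∣∩∣≡1 (sym ∣Aᵢ₀∣≡1)) (trans ∣∩∣≡1 (sym ∣Aⱼ∣≡1))))
          where
          ∣∩∣≡1 : ∣ A i₀ ∩ A j ∣ ≡ 1
          ∣∩∣≡1 = meet i₀∈P j∈P (j≢i₀ ∘ sym)
        c≡δc : ∀ j → c j ≡ δ i₀ j * c j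
        c≡δc j with j ≟ i₀
        ... | yes refl = sym (trans (cong (_* c j) (δ-refl j)) (ℤP.*-identityˡ (c j)))
        ... | no  j≢i₀ rewrite δ-≢ (j≢i₀ ∘ sym) = supported j j≢i₀
        C≡cᵢ₀ : C ≡ c i₀
        C≡cᵢ₀ = trans (sum-cong-≗ c≡δc) (∑-δ i₀ c)

    incidence-independent : ¬ LinearDependence P (χ ∘ A)
    incidence-independent = Gram.absurd

    fisher-inequality : ∀ {U} → (∀ {i} → i ∈ P → A i ⊆ U) → ∣ P ∣ ℕ.≤ ∣ U ∣
    fisher-inequality {U} A⊆U with ∣ P ∣ ℕ.≤? ∣ U ∣
    ... | yes ∣P∣≤∣U∣ = ∣P∣≤∣U∣
    ... | no  ∣P∣≰∣U∣ = ⊥-elim (incidence-independent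
      (∣U∣<∣P∣⇒LinearDependence p P U (χ ∘ A) (λ i∈P k∉U → χ-∉ (k∉U ∘ A⊆U i∈P)) (ℕP.≰⇒> ∣P∣≰∣U∣)))

module GraphBasics (G : Graph) where

  open import Data.Nat using (_<ᵇ_)
  open import Data.Nat.Properties using (<-cmp; <⇒<ᵇ; <-irrefl)
  open Graph G
  open Counting using (toSubset; ∈-toSubset⁺; count≡∣toSubset∣; ∣p∣≡1⇒x≡y)

  adj⇒≢ : ∀ {u w} → Adj G u w → u ≢ w
  adj⇒≢ {u} t refl = subst T (irrefl u) t

  adj-sym : ∀ {u w} → Adj G u w → Adj G w u
  adj-sym {u} {w} = subst T (symm u w)

  edge-adj : (e : Edge G) → Adj G (Edge.a e) (Edge.b e)
  edge-adj (edge _ _ isE) = proj₂ (Equivalence.to T-∧ isE)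

  edgeBetween : ∀ v w → Adj G v w → Edge G
  edgeBetween v w t with <-cmp (toℕ v) (toℕ w)
  ... | tri< v<w _ _ = edge v w (Equivalence.from T-∧ (<⇒<ᵇ v<w , t))
  ... | tri≈ _ v≡w _ = ⊥-elim (adj⇒≢ t (toℕ-injective v≡w))
  ... | tri> _ _ w<v = edge w v (Equivalence.from T-∧ (<⇒<ᵇ w<v , adj-sym t))

  module _ {v w} (t : Adj G v w) where

    edgeBetween-incidentˡ : Incident G v (edgeBetween v w t)
    edgeBetween-incidentˡ with <-cmp (toℕ v) (toℕ w)
    ... | tri< _ _ _   = inj₁ refl
    ... | tri≈ _ v≡w _ = ⊥-elim (adj⇒≢ t (toℕ-injective v≡w))
    ... | tri> _ _ _   = inj₂ refl

    edgeBetween-incidentʳ : Incident G w (edgeBetween v w t)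
    edgeBetween-incidentʳ with <-cmp (toℕ v) (toℕ w)
    ... | tri< _ _ _   = inj₂ refl
    ... | tri≈ _ v≡w _ = ⊥-elim (adj⇒≢ t (toℕ-injective v≡w))
    ... | tri> _ _ _   = inj₁ refl

    edgeBetween-endpoints : ∀ {u} → Incident G u (edgeBetween v w t) → u ≡ v ⊎ u ≡ w
    edgeBetween-endpoints u∈e with <-cmp (toℕ v) (toℕ w)
    ... | tri< _ _ _   = u∈e
    ... | tri≈ _ v≡w _ = ⊥-elim (adj⇒≢ t (toℕ-injective v≡w))
    ... | tri> _ _ _   = Data.Sum.swap u∈e

  edgeBetween-injective : ∀ {v w w′} (t : Adj G v w) (t′ : Adj G v w′) →
    edgeBetween v w t ≡ edgeBetween v w′ t′ → w ≡ w′
  edgeBetween-injective t t′ e≡e′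
    with edgeBetween-endpoints t′ (subst (Incident G _) e≡e′ (edgeBetween-incidentʳ t))
  ... | inj₁ w≡v  = ⊥-elim (adj⇒≢ t (sym w≡v))
  ... | inj₂ w≡w′ = w≡w′

  _≟ₑ_ : DecidableEquality (Edge G)
  edge a b p ≟ₑ edge a′ b′ p′ with a ≟ a′ | b ≟ b′
  ... | yes refl | yes refl = yes (cong (edge a b) (T-irrelevant p p′))
  ... | no a≢a′  | _        = no λ { refl → a≢a′ refl }
  ... | _        | no b≢b′  = no λ { refl → b≢b′ refl }

  degree≡∣neighbours∣ : ∀ v → degree G v ≡ ∣ toSubset (T? ∘ adj v) ∣
  degree≡∣neighbours∣ v = count≡∣toSubset∣ (T? ∘ adj v)

  plume-neighbour-unique : ∀ {w u u′} → Plume G w → Adj G w u → Adj G w u′ → u ≡ u′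
  plume-neighbour-unique {w} deg≡1 t t′ =
    ∣p∣≡1⇒x≡y (trans (sym (degree≡∣neighbours∣ w)) deg≡1) (∈-toSubset⁺ (T? ∘ adj w) t) (∈-toSubset⁺ (T? ∘ adj w) t′)

  critical⇒¬plume : ∀ {v} → Critical G v → ¬ Plume G v
  critical⇒¬plume (2≤deg , _) deg≡1 = <-irrefl (sym deg≡1) 2≤deg

  plume-edge-incident : ∀ {v w} → Plume G w → Adj G v w → ∀ f → Incident G w f → Incident G v f
  plume-edge-incident pw t (edge a b isE) (inj₁ refl) =
    inj₂ (plume-neighbour-unique pw (adj-sym t) (edge-adj (edge a b isE)))
  plume-edge-incident pw t (edge a b isE) (inj₂ refl) =
    inj₁ (plume-neighbour-unique pw (adj-sym t) (adj-sym (edge-adj (edge a b isE))))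

module PendantPoints (G : Graph) {p} (S : Edge G → Subset p) (rep : IsSimpleDistinctRep (LineAdj G) S) where

  open import Data.Fin.Subset using () renaming (⊥ to ∅)
  open import Data.Nat using (ℕ; _≤_)
  open import Data.Nat.ListAction using (sum)
  open import Data.Nat.Properties using (≤-antisym)
  open Graph G
  open GraphBasics G
  open Counting
  open Fisher using (fisher-inequality)

  private
    nonempty : ∀ e → Nonempty (S e)
    nonempty = proj₁ (proj₁ rep)
    lineAdj⇔meet : ∀ e f → e ≢ f → (LineAdj G e f → Nonempty (S e ∩ S f)) × (Nonempty (S e ∩ S f) → LineAdj G e f)
    lineAdj⇔meet = proj₂ (proj₁ rep)
    simple : ∀ e f → e ≢ f → ∣ S e ∩ S f ∣ ≤ 1
    simple = proj₁ (proj₂ rep)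
    distinct : ∀ e f → e ≢ f → S e ≢ S f
    distinct = proj₂ (proj₂ rep)

  sharedPoint⇒commonEndpoint : ∀ {e f k} → k ∈ S e → k ∈ S f → ∃ λ u → Incident G u e × Incident G u f
  sharedPoint⇒commonEndpoint {e} {f} k∈e k∈f with e ≟ₑ f
  ... | yes refl = Edge.a e , inj₁ refl , inj₁ refl
  ... | no  e≢f  = proj₂ (proj₂ (lineAdj⇔meet e f e≢f) (_ , x∈p∩q⁺ (k∈e , k∈f)))

  -- S of the edge vw, indexed by w; the junk value ∅ when v and w are not adjacent.
  pendantSet : Fin n → Fin n → Subset p
  pendantSet v w with T? (adj v w)
  ... | yes t = S (edgeBetween v w t)
  ... | no  _ = ∅

  pendantSet≡ : ∀ {v w} (t : Adj G v w) → pendantSet v w ≡ S (edgeBetween v w t)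
  pendantSet≡ {v} {w} t with T? (adj v w)
  ... | yes t′ = cong (S ∘ edgeBetween v w) (T-irrelevant t′ t)
  ... | no ¬t  = ⊥-elim (¬t t)

  plumesOf : Fin n → Subset n
  plumesOf v = toSubset (adjPlume? G v)

  InPendant : Fin n → Fin p → Set
  InPendant v k = ∃ λ w → AdjPlume G v w × k ∈ pendantSet v w

  inPendant? : ∀ v → Decidable (InPendant v)
  inPendant? v k = any? λ w → adjPlume? G v w ×-dec (k ∈? pendantSet v w)

  pendantPoints : Fin n → Subset p
  pendantPoints v = toSubset (inPendant? v)

  ∈-pendantPoints⁺ : ∀ {v w k} → AdjPlume G v w → k ∈ pendantSet v w → k ∈ pendantPoints v
  ∈-pendantPoints⁺ {v} {w} vw k∈ = ∈-toSubset⁺ (inPendant? v) (w , vw , k∈)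

  ∈-pendantPoints⁻ : ∀ {v k} → k ∈ pendantPoints v → ∃ λ w → Σ (AdjPlume G v w) λ vw → k ∈ S (edgeBetween v w (proj₁ vw))
  ∈-pendantPoints⁻ {v} k∈ with w , vw , k∈A ← ∈-toSubset⁻ (inPendant? v) k∈ =
    w , vw , subst (_ ∈_) (pendantSet≡ (proj₁ vw)) k∈A

  plumesAt≤∣pendantPoints∣ : ∀ v → plumesAt G v ≤ ∣ pendantPoints v ∣
  plumesAt≤∣pendantPoints∣ v = subst (_≤ ∣ pendantPoints v ∣) (sym (count≡∣toSubset∣ (adjPlume? G v)))
    (fisher-inequality {P = plumesOf v} {A = pendantSet v} nonempty′ meet′ distinct′
      (λ w∈P k∈ → ∈-pendantPoints⁺ (∈-toSubset⁻ (adjPlume? G v) w∈P) k∈))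
    where
    adjOf : ∀ {w} → w ∈ plumesOf v → Adj G v w
    adjOf = proj₁ ∘ ∈-toSubset⁻ (adjPlume? G v)
    edgeOf : ∀ {w} → w ∈ plumesOf v → Edge G
    edgeOf w∈P = edgeBetween v _ (adjOf w∈P)
    Sₑ≡ : ∀ {w} (w∈P : w ∈ plumesOf v) → pendantSet v w ≡ S (edgeOf w∈P)
    Sₑ≡ w∈P = pendantSet≡ (adjOf w∈P)
    edgeOf-≢ : ∀ {w w′} (w∈P : w ∈ plumesOf v) (w′∈P : w′ ∈ plumesOf v) → w ≢ w′ → edgeOf w∈P ≢ edgeOf w′∈P
    edgeOf-≢ w∈P w′∈P w≢w′ = w≢w′ ∘ edgeBetween-injective (adjOf w∈P) (adjOf w′∈P)

    nonempty′ : ∀ {w} → w ∈ plumesOf v → Nonempty (pendantSet v w)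
    nonempty′ w∈P rewrite Sₑ≡ w∈P = nonempty (edgeOf w∈P)
    meet′ : ∀ {w w′} → w ∈ plumesOf v → w′ ∈ plumesOf v → w ≢ w′ → ∣ pendantSet v w ∩ pendantSet v w′ ∣ ≡ 1
    meet′ w∈P w′∈P w≢w′ rewrite Sₑ≡ w∈P | Sₑ≡ w′∈P = ≤-antisym (simple _ _ e≢e′)
      (nonempty⇒∣p∣≥1 (proj₁ (lineAdj⇔meet _ _ e≢e′)
        (e≢e′ , v , edgeBetween-incidentˡ (adjOf w∈P) , edgeBetween-incidentˡ (adjOf w′∈P))))
      where
      e≢e′ : edgeOf w∈P ≢ edgeOf w′∈P
      e≢e′ = edgeOf-≢ w∈P w′∈P w≢w′
    distinct′ : ∀ {w w′} → w ∈ plumesOf v → w′ ∈ plumesOf v → w ≢ w′ → pendantSet v w ≢ pendantSet v w′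
    distinct′ w∈P w′∈P w≢w′ rewrite Sₑ≡ w∈P | Sₑ≡ w′∈P = distinct _ _ (edgeOf-≢ w∈P w′∈P w≢w′)

  pendantPoint⇒star : ∀ {v k} → k ∈ pendantPoints v → InducedByStar G S v k
  pendantPoint⇒star k∈ f k∈f
    with w , (t , pw) , k∈e ← ∈-pendantPoints⁻ k∈
    with u , u∈e , u∈f ← sharedPoint⇒commonEndpoint k∈e k∈f
    with edgeBetween-endpoints t u∈e
  ... | inj₁ refl = u∈f
  ... | inj₂ refl = plume-edge-incident pw t f u∈f

  pendantPoints-disjoint : ∀ {v v′ k} → Critical G v → Critical G v′ →
    k ∈ pendantPoints v → k ∈ pendantPoints v′ → v ≡ v′
  pendantPoints-disjoint cv cv′ k∈ k∈′
    with w , (t , pw) , k∈e ← ∈-pendantPoints⁻ k∈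
       | w′ , (t′ , pw′) , k∈e′ ← ∈-pendantPoints⁻ k∈′
    with u , u∈e , u∈e′ ← sharedPoint⇒commonEndpoint k∈e k∈e′
    with edgeBetween-endpoints t u∈e | edgeBetween-endpoints t′ u∈e′
  ... | inj₁ refl | inj₁ refl = refl
  ... | inj₁ refl | inj₂ refl = ⊥-elim (critical⇒¬plume cv pw′)
  ... | inj₂ refl | inj₁ refl = ⊥-elim (critical⇒¬plume cv′ pw)
  ... | inj₂ refl | inj₂ refl = plume-neighbour-unique pw (adj-sym t) (adj-sym t′)

  ∑plumesAt-critical≤∣Pc∣ : sum (map (plumesAt G) (filter (critical? G) (allFin n))) ≤ count (inPc? G S)
  ∑plumesAt-critical≤∣Pc∣ = subst (_ ≤_) (sym (count≡∣toSubset∣ (inPc? G S)))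
    (sum-≤-∣∣-disjoint pendantPoints (plumesAt G) (toSubset (inPc? G S)) _
      (filter⁺ (critical? G) (allFin⁺ n))
      (λ _ → plumesAt≤∣pendantPoints∣ _)
      (λ v∈ k∈ → ∈-toSubset⁺ (inPc? G S) (_ , critical v∈ , pendantPoint⇒star k∈))
      (λ v∈ v′∈ → pendantPoints-disjoint (critical v∈) (critical v′∈)))
    where
    critical : ∀ {v} → v ∈ₗ filter (critical? G) (allFin n) → Critical G v
    critical {v} v∈ = proj₂ (∈-filter⁻ (critical? G) {v} {allFin n} v∈)

open import Data.Nat using (ℕ; _≤_; _+_; _∸_)
open import Data.Nat.ListAction using (sum)
import Data.Nat.Properties as ℕP

mainTheorem11 : (G : Graph) → Connected G
    → (p : ℕ) (S : Edge G → Subset p)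
    → InFsd (LineAdj G) p S
    → p ≤ γ G
    → numPi G S ≤ numInland G
mainTheorem11 G _ p S (rep , _ , _) p≤γ = begin
  numPi G S                  ≡⟨ Counting.count-¬ (inPc? G S) ⟩
  p ∸ ∣Pc∣                   ≤⟨ ℕP.∸-monoˡ-≤ ∣Pc∣ p≤γ ⟩
  numInland G + M ∸ ∣Pc∣     ≤⟨ ℕP.∸-monoˡ-≤ ∣Pc∣ (ℕP.+-monoʳ-≤ (numInland G) M≤∣Pc∣) ⟩
  numInland G + ∣Pc∣ ∸ ∣Pc∣  ≡⟨ ℕP.m+n∸n≡m (numInland G) ∣Pc∣ ⟩
  numInland G                ∎
  where
  open ℕP.≤-Reasoning
  ∣Pc∣ M : ℕ
  ∣Pc∣ = count (inPc? G S)
  M = sum (map (plumesAt G) (filter (critical? G) (allFin (Graph.n G))))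
  M≤∣Pc∣ : M ≤ ∣Pc∣
  M≤∣Pc∣ = PendantPoints.∑plumesAt-critical≤∣Pc∣ G S rep
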